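{- Let $G$ and $H$ be graphs in $\Gamma_3$. If $G,H$ have negative or positive senders, then every minimal $(G,H,e,f)$-sender, either negative or positive, is connected.
   Context: All graphs are simple and finite. A 2-coloring of the edges of a graph $F=(V_F,E_F)$ is a map $\mathbf c:E_F\to\{0,1\}$ (0 = red, 1 = blue). For fixed graphs $G,H$, such a coloring is $(G,H)$-good if there is no subgraph of $F$ isomorphic to $G$ all of whose edges are red and no subgraph isomorphic to $H$ all of whose edges are blue. A positive $(G,H,e,f)$-sender is a graph $\mathcal T$ containing two edges $e,f$ (the signal edges) such that: (1) $\mathcal T$ has a $(G,H)$-good coloring; (2) $e$ and $f$ receive the same color in every $(G,H)$-good coloring of $\mathcal T$; (3) there is a $(G,H)$-good coloring of $\mathcal T$ in which $e$ is red and one in which $e$ is blue. A negative $(G,H,e,f)$-sender satisfies (1) and (3) and, instead of (2), that $e$ and $f$ receive different colors in every $(G,H)$-good coloring. "$G,H$ have negative (positive) senders" means some negative (positive) $(G,H,e,f)$-sender exists for some edges $e,f$. A sender with signal edges $e,f$ is minimal if none of its proper subgraphs is a sender of the same type with the same signal edges $e,f$. $\Gamma_3$ denotes the class consisting of all 3-connected graphs together with the triangle $K_3$. -}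

module Defs where

open import Data.Nat using (ℕ; _≤_; _≥_)
open import Data.Fin using (Fin)
open import Data.Fin.Subset using (Subset; _∈_; _∉_; ∣_∣)
open import Data.Bool using (Bool; true; false)
open import Data.Product using (Σ; _×_; ∃; ∃-syntax; _,_)
open import Data.Sum using (_⊎_)
open import Relation.Nullary using (¬_)
open import Relation.Binary.PropositionalEquality using (_≡_; _≢_)
open import Function.Definitions using (Injective)

record Graph : Set where
  field
    n      : ℕ
    Adj    : Fin n → Fin n → Bool
    symm   : ∀ i j → Adj i j ≡ Adj j i
    irrefl : ∀ i → Adj i i ≡ false
open Graph public

-- An edge of F: an (ordered representative of an) adjacent pair.
Edge : Graph → Set
Edge F = Σ (Fin (n F)) λ i → Σ (Fin (n F)) λ j → Adj F i j ≡ true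

-- A 2-colouring of the edges of F (false = 0 = red, true = 1 = blue),
-- given symmetrically on pairs of vertices; only values on edges matter.
record Coloring (F : Graph) : Set where
  field
    col     : Fin (n F) → Fin (n F) → Bool
    colSymm : ∀ i j → col i j ≡ col j i
open Coloring public

colorOf : {F : Graph} → Coloring F → Edge F → Bool
colorOf c (i , j , _) = col c i j

MonoCopy : (G F : Graph) → Coloring F → Bool → Set
MonoCopy G F c b =
  Σ (Fin (n G) → Fin (n F)) λ φ →
    Injective _≡_ _≡_ φ ×
    (∀ u v → Adj G u v ≡ true →
       (Adj F (φ u) (φ v) ≡ true) × (col c (φ u) (φ v) ≡ b))

Good : (G H F : Graph) → Coloring F → Set
Good G H F c = ¬ MonoCopy G F c false × ¬ MonoCopy H F c true

data Sign : Set where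
  positive negative : Sign

SignalRel : Sign → Bool → Bool → Set
SignalRel positive x y = x ≡ y
SignalRel negative x y = x ≢ y

IsSender : Sign → (G H T : Graph) → Edge T → Edge T → Set
IsSender s G H T e f =
  (∃[ c ] Good G H T c) ×
  (∀ c → Good G H T c → SignalRel s (colorOf c e) (colorOf c f)) ×
  (∃[ c ] (Good G H T c × colorOf c e ≡ false)) ×
  (∃[ c ] (Good G H T c × colorOf c e ≡ true))

HasSender : Sign → (G H : Graph) → Set
HasSender s G H = ∃[ T ] ∃[ e ] ∃[ f ] IsSender s G H T e f

record Subgraph (T : Graph) : Set where
  field
    S      : Graph
    ι      : Fin (n S) → Fin (n T)
    ι-inj  : Injective _≡_ _≡_ ι
    ι-edge : ∀ a b → Adj S a b ≡ true → Adj T (ι a) (ι b) ≡ true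
open Subgraph public

Proper : {T : Graph} → Subgraph T → Set
Proper {T} P =
  (∃[ v ] (∀ a → ι P a ≢ v)) ⊎
  (∃[ a ] ∃[ b ] (Adj T (ι P a) (ι P b) ≡ true × Adj (S P) a b ≡ false))

EdgeMaps : {T : Graph} (P : Subgraph T) → Edge (S P) → Edge T → Set
EdgeMaps P (a , b , _) (i , j , _) =
  (ι P a ≡ i × ι P b ≡ j) ⊎ (ι P a ≡ j × ι P b ≡ i)

IsMinimalSender : Sign → (G H T : Graph) → Edge T → Edge T → Set
IsMinimalSender s G H T e f =
  IsSender s G H T e f ×
  ¬ (Σ (Subgraph T) λ P → Proper P ×
       Σ (Edge (S P)) λ e' → Σ (Edge (S P)) λ f' →
         EdgeMaps P e' e × EdgeMaps P f' f × IsSender s G H (S P) e' f')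

data ReachAvoid (F : Graph) (X : Subset (n F)) : Fin (n F) → Fin (n F) → Set where
  here : ∀ {u} → u ∉ X → ReachAvoid F X u u
  step : ∀ {u v w} → u ∉ X → Adj F u v ≡ true → ReachAvoid F X v w →
         ReachAvoid F X u w

data Reach (F : Graph) : Fin (n F) → Fin (n F) → Set where
  here : ∀ {u} → Reach F u u
  step : ∀ {u v w} → Adj F u v ≡ true → Reach F v w → Reach F u w

Connected : Graph → Set
Connected F = ∀ u v → Reach F u v

ThreeConnected : Graph → Set
ThreeConnected G =
  n G ≥ 4 ×
  (∀ (X : Subset (n G)) → ∣ X ∣ ≤ 2 →
     ∀ u v → u ∉ X → v ∉ X → ReachAvoid G X u v)

IsTriangle : Graph → Set
IsTriangle G = (n G ≡ 3) × (∀ i j → i ≢ j → Adj G i j ≡ true)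

InΓ₃ : Graph → Set
InΓ₃ G = IsTriangle G ⊎ ThreeConnected G

-- Since G and H are connected, a monochromatic copy of either lies inside a
-- single component of T, so colourings of different components of T can be
-- combined freely. If f lay outside the component C of e, combining a good
-- colouring with e blue on C with a good colouring with e red off C would force
-- the signal relation for both colours of e. Hence e and f lie in C. If T had
-- a vertex outside C, deleting it would leave a sender with the same signal
-- edges: good colourings restrict, and a good colouring of the smaller graph
-- extends by any good colouring of T off C. This contradicts minimality.
module Submission where

open import Defs
open import Data.Bool using (Bool; true; false; _∧_; if_then_else_) renaming (_≟_ to _≟ᵇ_)
open import Data.Bool.Properties using (∧-comm)
open import Data.Nat using (zero; suc; z≤n; s≤s)
open import Data.Nat.Properties using (≤-trans; ≤-reflexive)
open import Data.Fin using (Fin; zero; _≟_; fromℕ<; punchIn; punchOut)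
open import Data.Fin.Properties using (any?; punchIn-injective; punchInᵢ≢i; punchIn-punchOut)
open import Data.Fin.Subset using (Subset; _∉_; _⊆_; _⊂_; _∪_; ⁅_⁆; ⊥)
open import Data.Fin.Subset.Properties using (_∈?_; ∉⊥; ∣⊥∣≡0; p⊆p∪q; x∈p∪q⁺; x∈p∪q⁻; x∈⁅x⁆; x∈⁅y⁆⇒x≡y)
open import Data.Fin.Subset.Induction using (⊃-wellFounded)
open import Data.Product using (Σ; _×_; ∃-syntax; _,_; proj₁; proj₂)
open import Data.Sum using (_⊎_; inj₁; inj₂; [_,_]′)
open import Data.Empty using (⊥-elim)
open import Function using (_∘_)
open import Induction.WellFounded using (module All)
open import Relation.Nullary using (¬_; Dec; yes; no; does)
open import Relation.Nullary.Decidable using (map′; _×-dec_; dec-true; dec-false)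
open import Relation.Binary.PropositionalEquality using (_≡_; _≢_; refl; sym; trans; cong; cong₂; subst; subst₂)

Adj-sym : (F : Graph) {u v : Fin (n F)} → Adj F u v ≡ true → Adj F v u ≡ true
Adj-sym F {u} {v} = trans (symm F v u)

Reach-++ : {F : Graph} {u v w : Fin (n F)} → Reach F u v → Reach F v w → Reach F u w
Reach-++ here       q = q
Reach-++ (step a p) q = step a (Reach-++ p q)

Reach-reverse : {F : Graph} {u v : Fin (n F)} → Reach F u v → Reach F v u
Reach-reverse         here       = here
Reach-reverse {F = F} (step a p) = Reach-++ (Reach-reverse p) (step (Adj-sym F a) here)

module _ {F : Graph} where

  ReachAvoid⇒Reach : {X : Subset (n F)} {u v : Fin (n F)} → ReachAvoid F X u v → Reach F u v
  ReachAvoid⇒Reach (here _)     = here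
  ReachAvoid⇒Reach (step _ a p) = step a (ReachAvoid⇒Reach p)

  Reach⇒ReachAvoid⊥ : {u v : Fin (n F)} → Reach F u v → ReachAvoid F ⊥ u v
  Reach⇒ReachAvoid⊥ here       = here ∉⊥
  Reach⇒ReachAvoid⊥ (step a p) = step ∉⊥ a (Reach⇒ReachAvoid⊥ p)

  ReachAvoid-start : {X : Subset (n F)} {u v : Fin (n F)} → ReachAvoid F X u v → u ∉ X
  ReachAvoid-start (here u∉X)     = u∉X
  ReachAvoid-start (step u∉X _ _) = u∉X

  ReachAvoid-antimono : {X Y : Subset (n F)} {u v : Fin (n F)} →
                        X ⊆ Y → ReachAvoid F Y u v → ReachAvoid F X u v
  ReachAvoid-antimono X⊆Y (here u∉Y)     = here (u∉Y ∘ X⊆Y)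
  ReachAvoid-antimono X⊆Y (step u∉Y a p) = step (u∉Y ∘ X⊆Y) a (ReachAvoid-antimono X⊆Y p)

  private
    ∉-∪⁅⁆ : {X : Subset (n F)} {x u : Fin (n F)} → x ∉ X → x ≢ u → x ∉ X ∪ ⁅ u ⁆
    ∉-∪⁅⁆ {X} x∉X x≢u = [ x∉X , x≢u ∘ x∈⁅y⁆⇒x≡y _ ]′ ∘ x∈p∪q⁻ X _

    ⊂-∪⁅⁆ : {X : Subset (n F)} {u : Fin (n F)} → u ∉ X → X ⊂ X ∪ ⁅ u ⁆
    ⊂-∪⁅⁆ {u = u} u∉X = p⊆p∪q _ , u , x∈p∪q⁺ (inj₂ (x∈⁅x⁆ u)) , u∉X

    lastExit : {X : Subset (n F)} {u w v : Fin (n F)} → u ≢ v → ReachAvoid F X w v →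
               ReachAvoid F (X ∪ ⁅ u ⁆) w v ⊎
               ∃[ w′ ] (Adj F u w′ ≡ true × ReachAvoid F (X ∪ ⁅ u ⁆) w′ v)
    lastExit u≢v (here v∉X) = inj₁ (here (∉-∪⁅⁆ v∉X (u≢v ∘ sym)))
    lastExit {u = u} u≢v (step {w} w∉X a p) with lastExit u≢v p
    ... | inj₂ exit = inj₂ exit
    ... | inj₁ p′ with w ≟ u
    ...   | yes refl = inj₂ (_ , a , p′)
    ...   | no w≢u   = inj₁ (step (∉-∪⁅⁆ w∉X w≢u) a p′)

  ReachAvoid-leave : {X : Subset (n F)} {u v : Fin (n F)} → u ≢ v → ReachAvoid F X u v →
                     ∃[ w ] (Adj F u w ≡ true × ReachAvoid F (X ∪ ⁅ u ⁆) w v)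
  ReachAvoid-leave u≢v (here _) = ⊥-elim (u≢v refl)
  ReachAvoid-leave u≢v (step _ a p) with lastExit u≢v p
  ... | inj₁ p′   = _ , a , p′
  ... | inj₂ exit = exit

  ReachAvoid? : (X : Subset (n F)) (u v : Fin (n F)) → Dec (ReachAvoid F X u v)
  ReachAvoid? = All.wfRec ⊃-wellFounded _ (λ X → ∀ u v → Dec (ReachAvoid F X u v)) decide
    where
    decide : ∀ X → (∀ {Y} → X ⊂ Y → ∀ u v → Dec (ReachAvoid F Y u v)) →
             ∀ u v → Dec (ReachAvoid F X u v)
    decide X rec u v with u ∈? X | u ≟ v
    ... | yes u∈X | _      = no λ p → ReachAvoid-start p u∈X
    ... | no u∉X  | yes refl = yes (here u∉X)
    ... | no u∉X  | no u≢v = map′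
      (λ (w , a , p) → step u∉X a (ReachAvoid-antimono (p⊆p∪q _) p))
      (ReachAvoid-leave u≢v)
      (any? λ w → (Adj F u w ≟ᵇ true) ×-dec rec (⊂-∪⁅⁆ u∉X) w v)

Reach? : (F : Graph) (u v : Fin (n F)) → Dec (Reach F u v)
Reach? F u v = map′ ReachAvoid⇒Reach Reach⇒ReachAvoid⊥ (ReachAvoid? ⊥ u v)

InΓ₃⇒Connected : (G : Graph) → InΓ₃ G → Connected G
InΓ₃⇒Connected _ (inj₁ (_ , adjacent)) u v with u ≟ v
... | yes refl = here
... | no u≢v   = step (adjacent u v u≢v) here
InΓ₃⇒Connected G (inj₂ (_ , avoid)) u v =
  ReachAvoid⇒Reach (avoid ⊥ (≤-trans (≤-reflexive (∣⊥∣≡0 (n G))) z≤n) u v ∉⊥ ∉⊥)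

InΓ₃⇒vertex : (G : Graph) → InΓ₃ G → Fin (n G)
InΓ₃⇒vertex _ (inj₁ (n≡3 , _)) = subst Fin (sym n≡3) zero
InΓ₃⇒vertex _ (inj₂ (n≥4 , _)) = fromℕ< (≤-trans (s≤s z≤n) n≥4)

Closed : (F : Graph) → (Fin (n F) → Bool) → Set
Closed F z = ∀ u v → Adj F u v ≡ true → z u ≡ z v

Closed-Reach : {F : Graph} {z : Fin (n F) → Bool} → Closed F z →
               {u v : Fin (n F)} → Reach F u v → z u ≡ z v
Closed-Reach z-closed here       = refl
Closed-Reach z-closed (step a p) = trans (z-closed _ _ a) (Closed-Reach z-closed p)

Closed-edge : (F : Graph) {z : Fin (n F) → Bool} → Closed F z →
              ((i , j , _) : Edge F) → z i ≡ true → z j ≡ true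
Closed-edge _ z-closed (i , j , a) zi = trans (sym (z-closed i j a)) zi

component : (F : Graph) → Fin (n F) → Fin (n F) → Bool
component F r v = does (Reach? F r v)

module _ (F : Graph) (r : Fin (n F)) where

  Reach⇒component : {v : Fin (n F)} → Reach F r v → component F r v ≡ true
  Reach⇒component = dec-true (Reach? F r _)

  ¬Reach⇒component : {v : Fin (n F)} → ¬ Reach F r v → component F r v ≡ false
  ¬Reach⇒component = dec-false (Reach? F r _)

  component⇒Reach : {v : Fin (n F)} → component F r v ≡ true → Reach F r v
  component⇒Reach {v} inside with Reach? F r v
  ... | yes r→v = r→v
  ... | no ¬r→v with trans (sym inside) (¬Reach⇒component ¬r→v)
  ...   | ()

  component-closed : Closed F (component F r)
  component-closed u v a with Reach? F r u
  ... | yes r→u = trans (Reach⇒component r→u) (sym (Reach⇒component (Reach-++ r→u (step a here))))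
  ... | no ¬r→u = trans (¬Reach⇒component ¬r→u)
                        (sym (¬Reach⇒component (¬r→u ∘ λ r→v → Reach-++ r→v (step (Adj-sym F a) here))))

Closed-pullback : {K T : Graph} {z : Fin (n T) → Bool} (φ : Fin (n K) → Fin (n T)) →
                  (∀ u v → Adj K u v ≡ true → Adj T (φ u) (φ v) ≡ true) →
                  Closed T z → Closed K (z ∘ φ)
Closed-pullback φ φ-edge z-closed u v a = z-closed (φ u) (φ v) (φ-edge u v a)

MonoCopy-constant : {K T : Graph} {z : Fin (n T) → Bool} {c : Coloring T} {b : Bool} →
                    Closed T z → Connected K → ((φ , _) : MonoCopy K T c b) →
                    ∀ a a′ → z (φ a) ≡ z (φ a′)
MonoCopy-constant {K} {T} z-closed K-conn (φ , _ , φ-edge) a a′ =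
  Closed-Reach (Closed-pullback {K} {T} φ (λ u v → proj₁ ∘ φ-edge u v) z-closed) (K-conn a a′)

MonoCopy-recolor : {T : Graph} (K : Graph) {b : Bool} (c c′ : Coloring T) ((φ , _) : MonoCopy K T c b) →
                   (∀ u v → col c (φ u) (φ v) ≡ col c′ (φ u) (φ v)) → MonoCopy K T c′ b
MonoCopy-recolor _ c c′ (φ , φ-inj , φ-edge) agree =
  φ , φ-inj , λ u v a → proj₁ (φ-edge u v a) , trans (sym (agree u v)) (proj₂ (φ-edge u v a))

MonoCopyWithin : (K T : Graph) → (Fin (n T) → Bool) → Coloring T → Bool → Set
MonoCopyWithin K T z c b = Σ (MonoCopy K T c b) λ (φ , _) → ∀ a → z (φ a) ≡ true

GoodWithin : (G H T : Graph) → (Fin (n T) → Bool) → Coloring T → Set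
GoodWithin G H T z c = ¬ MonoCopyWithin G T z c false × ¬ MonoCopyWithin H T z c true

Good⇒GoodWithin : {G H T : Graph} {z : Fin (n T) → Bool} (c : Coloring T) →
                  Good G H T c → GoodWithin G H T z c
Good⇒GoodWithin _ (no-G , no-H) = no-G ∘ proj₁ , no-H ∘ proj₁

module Glue {T : Graph} (z : Fin (n T) → Bool) where

  glue : Coloring T → Coloring T → Coloring T
  glue c₁ c₂ = record
    { col     = λ a b → if z a ∧ z b then col c₁ a b else col c₂ a b
    ; colSymm = glue-symm
    }
    where
    glue-symm : ∀ a b → (if z a ∧ z b then col c₁ a b else col c₂ a b) ≡
                        (if z b ∧ z a then col c₁ b a else col c₂ b a)
    glue-symm a b rewrite ∧-comm (z a) (z b) | colSymm c₁ a b | colSymm c₂ a b = refl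

  glue-inside : ∀ c₁ c₂ a b → z a ≡ true → z b ≡ true → col (glue c₁ c₂) a b ≡ col c₁ a b
  glue-inside c₁ c₂ a b za zb rewrite za | zb = refl

  glue-outside : ∀ c₁ c₂ a b → z a ≡ false → col (glue c₁ c₂) a b ≡ col c₂ a b
  glue-outside c₁ c₂ a b za rewrite za = refl

  module _ (z-closed : Closed T z) where

    glue-¬MonoCopy : {K : Graph} → Connected K → Fin (n K) → (c₁ c₂ : Coloring T) {b : Bool} →
                     ¬ MonoCopyWithin K T z c₁ b → ¬ MonoCopy K T c₂ b →
                     ¬ MonoCopy K T (glue c₁ c₂) b
    glue-¬MonoCopy {K} K-conn a₀ c₁ c₂ no-c₁ no-c₂ copy@(φ , _) with z (φ a₀) in side
    ... | true  = no-c₁ (MonoCopy-recolor K (glue c₁ c₂) c₁ copy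
                           (λ u v → glue-inside c₁ c₂ (φ u) (φ v) (inside u) (inside v)) , inside)
      where
      inside : ∀ a → z (φ a) ≡ true
      inside a = trans (MonoCopy-constant {K} {T} {c = glue c₁ c₂} z-closed K-conn copy a a₀) side
    ... | false = no-c₂ (MonoCopy-recolor K (glue c₁ c₂) c₂ copy
                           (λ u v → glue-outside c₁ c₂ (φ u) (φ v) (outside u)))
      where
      outside : ∀ a → z (φ a) ≡ false
      outside a = trans (MonoCopy-constant {K} {T} {c = glue c₁ c₂} z-closed K-conn copy a a₀) side

    glue-good : {G H : Graph} → Connected G → Fin (n G) → Connected H → Fin (n H) →
                (c₁ c₂ : Coloring T) → GoodWithin G H T z c₁ → Good G H T c₂ →
                Good G H T (glue c₁ c₂)
    glue-good G-conn g₀ H-conn h₀ c₁ c₂ (no-G₁ , no-H₁) (no-G₂ , no-H₂) =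
      glue-¬MonoCopy G-conn g₀ c₁ c₂ no-G₁ no-G₂ , glue-¬MonoCopy H-conn h₀ c₁ c₂ no-H₁ no-H₂

¬SignalRel-both : ∀ s {x} → ¬ (SignalRel s false x × SignalRel s true x)
¬SignalRel-both positive         (refl , ())
¬SignalRel-both negative {false} (false≢false , _) = false≢false refl
¬SignalRel-both negative {true}  (_ , true≢true)   = true≢true refl

module _ {T : Graph} (P : Subgraph T) where

  restrict : Coloring T → Coloring (S P)
  restrict c = record
    { col     = λ a b → col c (ι P a) (ι P b)
    ; colSymm = λ a b → colSymm c (ι P a) (ι P b)
    }

  restrict-¬MonoCopy : (K : Graph) (c : Coloring T) {b : Bool} →
                       ¬ MonoCopy K T c b → ¬ MonoCopy K (S P) (restrict c) b
  restrict-¬MonoCopy _ _ no-copy (φ , φ-inj , φ-edge) =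
    no-copy (ι P ∘ φ , φ-inj ∘ ι-inj P ,
             λ u v a → ι-edge P _ _ (proj₁ (φ-edge u v a)) , proj₂ (φ-edge u v a))

  restrict-good : {G H : Graph} (c : Coloring T) → Good G H T c → Good G H (S P) (restrict c)
  restrict-good {G} {H} c (no-G , no-H) = restrict-¬MonoCopy G c no-G , restrict-¬MonoCopy H c no-H

  restrict-colorOf : (c : Coloring T) (e′ : Edge (S P)) (e : Edge T) →
                     EdgeMaps P e′ e → colorOf (restrict c) e′ ≡ colorOf c e
  restrict-colorOf c _ (i , j , _) (inj₁ (a↦i , b↦j)) = cong₂ (col c) a↦i b↦j
  restrict-colorOf c _ (i , j , _) (inj₂ (a↦j , b↦i)) = trans (cong₂ (col c) a↦j b↦i) (colSymm c j i)

record InducedCover (T : Graph) (z : Fin (n T) → Bool) : Set where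
  field
    sub       : Subgraph T
    induced   : ∀ a b → Adj (S sub) a b ≡ Adj T (ι sub a) (ι sub b)
    retract   : Fin (n T) → Fin (n (S sub))
    ι-retract : ∀ v → z v ≡ true → ι sub (retract v) ≡ v

module Cover {T : Graph} {z : Fin (n T) → Bool} (z-closed : Closed T z) (C : InducedCover T z) where
  open InducedCover C

  retract-adj : ∀ {v w} → z v ≡ true → z w ≡ true → Adj T v w ≡ true →
                Adj (S sub) (retract v) (retract w) ≡ true
  retract-adj {v} {w} zv zw a =
    trans (induced _ _)
          (subst₂ (λ p q → Adj T p q ≡ true) (sym (ι-retract v zv)) (sym (ι-retract w zw)) a)

  pullEdge : (e : Edge T) → z (proj₁ e) ≡ true → Edge (S sub)
  pullEdge e@(i , j , a) zi = retract i , retract j , retract-adj zi (Closed-edge T z-closed e zi) a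

  pullEdge-maps : (e : Edge T) (zi : z (proj₁ e) ≡ true) → EdgeMaps sub (pullEdge e zi) e
  pullEdge-maps e@(i , j , _) zi = inj₁ (ι-retract i zi , ι-retract j (Closed-edge T z-closed e zi))

  lift : Coloring (S sub) → Coloring T
  lift c = record
    { col     = λ v w → col c (retract v) (retract w)
    ; colSymm = λ v w → colSymm c (retract v) (retract w)
    }

  lift-¬MonoCopyWithin : (K : Graph) (c : Coloring (S sub)) {b : Bool} →
                         ¬ MonoCopy K (S sub) c b → ¬ MonoCopyWithin K T z (lift c) b
  lift-¬MonoCopyWithin _ _ no-copy ((φ , φ-inj , φ-edge) , inside) =
    no-copy (retract ∘ φ , retract∘φ-inj ,
             λ u v a → retract-adj (inside u) (inside v) (proj₁ (φ-edge u v a)) , proj₂ (φ-edge u v a))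
    where
    retract∘φ-inj : ∀ {a a′} → retract (φ a) ≡ retract (φ a′) → a ≡ a′
    retract∘φ-inj {a} {a′} eq =
      φ-inj (trans (sym (ι-retract _ (inside a))) (trans (cong (ι sub) eq) (ι-retract _ (inside a′))))

  lift-goodWithin : {G H : Graph} (c : Coloring (S sub)) → Good G H (S sub) c → GoodWithin G H T z (lift c)
  lift-goodWithin {G} {H} c (no-G , no-H) = lift-¬MonoCopyWithin G c no-G , lift-¬MonoCopyWithin H c no-H

deleteVertex : (T : Graph) (z : Fin (n T) → Bool) (y r : Fin (n T)) → z y ≡ false → z r ≡ true →
               Σ (InducedCover T z) (Proper ∘ InducedCover.sub)
deleteVertex record { n = zero } z () r zy zr
deleteVertex T@(record { n = suc m }) z y r zy zr = cover , inj₁ (y , punchInᵢ≢i y)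
  where
  T-y : Graph
  T-y = record
    { n      = m
    ; Adj    = λ a b → Adj T (punchIn y a) (punchIn y b)
    ; symm   = λ a b → symm T (punchIn y a) (punchIn y b)
    ; irrefl = λ a → irrefl T (punchIn y a)
    }

  y≢inside : ∀ {v} → z v ≡ true → y ≢ v
  y≢inside zv refl with trans (sym zy) zv
  ... | ()

  -- r is only a default value, so that retract is total.
  retract : Fin (suc m) → Fin m
  retract v with y ≟ v
  ... | yes _  = punchOut (y≢inside zr)
  ... | no y≢v = punchOut y≢v

  ι-retract : ∀ v → z v ≡ true → punchIn y (retract v) ≡ v
  ι-retract v zv with y ≟ v
  ... | yes y≡v = ⊥-elim (y≢inside zv y≡v)
  ... | no y≢v  = punchIn-punchOut y≢v

  cover : InducedCover T z
  cover = record
    { sub       = record { S = T-y ; ι = punchIn y ; ι-inj = punchIn-injective y _ _ ; ι-edge = λ _ _ a → a }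
    ; induced   = λ _ _ → refl
    ; retract   = retract
    ; ι-retract = ι-retract
    }

module Senders {G H : Graph} (G-conn : Connected G) (g₀ : Fin (n G)) (H-conn : Connected H) (h₀ : Fin (n H))
               (s : Sign) {T : Graph} {z : Fin (n T) → Bool} (z-closed : Closed T z) where
  open Glue {T} z

  -- Off z the glued colouring agrees with cʳ, so f keeps its colour while e
  -- turns blue.
  signal-edges-same-side : (e f : Edge T) → IsSender s G H T e f →
                           z (proj₁ e) ≡ true → z (proj₁ f) ≡ true
  signal-edges-same-side e@(e₁ , e₂ , _) (f₁ , f₂ , _)
                         (_ , signal , (cʳ , goodʳ , e-red) , (cᵇ , goodᵇ , e-blue)) ze
    with z f₁ in zf
  ... | true  = refl
  ... | false = ⊥-elim (¬SignalRel-both s (red-signal , glued-signal))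
    where
    red-signal : SignalRel s false (col cʳ f₁ f₂)
    red-signal = subst (λ x → SignalRel s x (col cʳ f₁ f₂)) e-red (signal cʳ goodʳ)

    glued-signal : SignalRel s true (col cʳ f₁ f₂)
    glued-signal = subst₂ (SignalRel s)
      (trans (glue-inside cᵇ cʳ e₁ e₂ ze (Closed-edge T z-closed e ze)) e-blue)
      (glue-outside cᵇ cʳ f₁ f₂ zf)
      (signal (glue cᵇ cʳ)
              (glue-good z-closed G-conn g₀ H-conn h₀ cᵇ cʳ
                         (Good⇒GoodWithin {G} {H} {T} {z} cᵇ goodᵇ) goodʳ))

  module _ (C : InducedCover T z) where
    open InducedCover C
    open Cover z-closed C

    restrict-sender : (e f : Edge T) → IsSender s G H T e f →
                      (ze : z (proj₁ e) ≡ true) (zf : z (proj₁ f) ≡ true) →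
                      IsSender s G H (S sub) (pullEdge e ze) (pullEdge f zf)
    restrict-sender e@(e₁ , e₂ , _) f@(f₁ , f₂ , _)
                    ((c₀ , good₀) , signal , (cʳ , goodʳ , e-red) , (cᵇ , goodᵇ , e-blue)) ze zf =
        (restrict sub c₀ , restrict-good sub {G} {H} c₀ good₀)
      , (λ c good → subst₂ (SignalRel s)
                      (glue-inside (lift c) c₀ e₁ e₂ ze (Closed-edge T z-closed e ze))
                      (glue-inside (lift c) c₀ f₁ f₂ zf (Closed-edge T z-closed f zf))
                      (signal (glue (lift c) c₀)
                              (glue-good z-closed G-conn g₀ H-conn h₀ (lift c) c₀
                                         (lift-goodWithin {G} {H} c good) good₀)))
      , (restrict sub cʳ , restrict-good sub {G} {H} cʳ goodʳ ,
         trans (restrict-colorOf sub cʳ (pullEdge e ze) e (pullEdge-maps e ze)) e-red)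
      , (restrict sub cᵇ , restrict-good sub {G} {H} cᵇ goodᵇ ,
         trans (restrict-colorOf sub cᵇ (pullEdge e ze) e (pullEdge-maps e ze)) e-blue)

  minimal⇒covered : (e f : Edge T) → IsMinimalSender s G H T e f →
                    z (proj₁ e) ≡ true → ∀ v → z v ≡ true
  minimal⇒covered e f (sender , minimal) ze v with z v in zv
  ... | true  = refl
  ... | false with deleteVertex T z v (proj₁ e) zv ze
  ...   | cover , proper = ⊥-elim (minimal (sub , proper , pullEdge e ze , pullEdge f zf ,
                                            pullEdge-maps e ze , pullEdge-maps f zf ,
                                            restrict-sender cover e f sender ze zf))
    where
    open InducedCover cover
    open Cover z-closed cover
    zf : z (proj₁ f) ≡ true
    zf = signal-edges-same-side e f sender ze

theorem1 : (G H : Graph) → InΓ₃ G → InΓ₃ H →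
    (HasSender negative G H ⊎ HasSender positive G H) →
    (s : Sign) (T : Graph) (e f : Edge T) →
    IsMinimalSender s G H T e f → Connected T
theorem1 G H γG γH _ s T e f minimal u v = Reach-++ (Reach-reverse (from-e u)) (from-e v)
  where
  open Senders (InΓ₃⇒Connected G γG) (InΓ₃⇒vertex G γG) (InΓ₃⇒Connected H γH) (InΓ₃⇒vertex H γH)
               s (component-closed T (proj₁ e))

  from-e : ∀ w → Reach T (proj₁ e) w
  from-e w = component⇒Reach T (proj₁ e)
               (minimal⇒covered e f minimal (Reach⇒component T (proj₁ e) here) w)
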